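{- Let $a$ be a positive integer and $p$ a prime number. (A) The number $a$ appears an odd number of times among the partial quotients $a_1,\ldots,a_{T_p}$ of $\sqrt{p}$ if and only if (1) $a$ is odd, $p\equiv 3\pmod 4$ and $a^2<p<(a+2)^2$; or (2) $a$ is even and $\frac{a^2}{4}<p<\frac{(a+2)^2}{4}$. (B) Assume moreover that $p$ is odd. Then $a$ appears an odd number of times among the partial quotients $a_1,\ldots,a_{T_{2p}}$ of $\sqrt{2p}$ if and only if $a$ is even and either $\frac{a^2}{8}<p<\frac{(a+2)^2}{8}$, or $\frac{a^2}{2}<p<\frac{(a+2)^2}{2}$ and $T_{2p}$ is even.
   Context: For a positive integer $D$ that is not a perfect square, the continued fraction of $\sqrt{D}$ is written $\sqrt{D}=[a_0;\overline{a_1,\ldots,a_l}]$, where $l=T_D$ is the (minimal) length of the period. It is known that $a_0=\lfloor\sqrt D\rfloor$, $a_l=2a_0$ and $a_{l-j}=a_j$ for $1\le j\le l-1$. "$a$ appears an odd number of times in the period" means that the number of indices $j\in\{1,\ldots,l\}$ with $a_j=a$ is odd. -}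

module Defs where

open import Data.Nat using (ℕ; zero; suc; _+_; _*_; _∸_; _≤_; _≤ᵇ_)
open import Data.Nat.DivMod using (_/_)
open import Data.Bool using (if_then_else_)
open import Data.Product using (_×_; _,_; proj₁; proj₂)
open import Data.List using (List; length; filter; map; upTo)
open import Relation.Binary.PropositionalEquality using (_≡_)
import Data.Nat as N

isqrt : ℕ → ℕ
isqrt zero = zero
isqrt (suc n) with isqrt n
... | s = if (suc s * suc s) ≤ᵇ suc n then suc s else s

-- division, with the (never used for non-square D) convention x / 0 = 0
divN : ℕ → ℕ → ℕ
divN x zero = zero
divN x (suc k) = x / suc k

-- Complete quotients of √D: x_n = (m_n + √D) / d_n, with m_0 = 0, d_0 = 1,
--   a_n = ⌊x_n⌋ = ⌊(a_0 + m_n)/d_n⌋,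
--   m_{n+1} = a_n d_n - m_n,  d_{n+1} = (D - m_{n+1}^2)/d_n.
-- (standard continued fraction algorithm for quadratic irrationals)
state : ℕ → ℕ → ℕ × ℕ
state D zero = 0 , 1
state D (suc n) =
  let m = proj₁ (state D n)
      d = proj₂ (state D n)
      a = divN (isqrt D + m) d
      m' = a * d ∸ m
  in m' , divN (D ∸ m' * m') d

cf : ℕ → ℕ → ℕ
cf D n = divN (isqrt D + proj₁ (state D n)) (proj₂ (state D n))

IsPeriod : ℕ → ℕ → Set
IsPeriod D l = 1 ≤ l × (∀ n → 1 ≤ n → cf D (n + l) ≡ cf D n)

IsMinPeriod : ℕ → ℕ → Set
IsMinPeriod D l = IsPeriod D l × (∀ k → IsPeriod D k → l ≤ k)

count : ℕ → ℕ → ℕ → ℕ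
count D l a = length (filter (λ j → cf D j N.≟ a) (map suc (upTo l)))

{-# OPTIONS --safe #-}
module Submission where

open import Defs
open import Data.Nat using (ℕ; _+_; _*_; _%_; _≤_; _<_)
open import Data.Nat.Primality using (Prime)
open import Data.Product using (_×_)
open import Data.Sum using (_⊎_)
open import Function.Bundles using (_⇔_)
open import Relation.Binary.PropositionalEquality using (_≡_)

open import Data.Nat
open import Data.Nat.Properties
open import Data.Nat.DivMod
open import Data.Nat.Divisibility
open import Data.Nat.Coprimality using (Coprime; coprime-divisor; coprime-+; 1-coprimeTo; prime⇒coprime)
open import Data.Nat.Primality using (prime⇒irreducible; prime⇒nonTrivial; prime⇒nonZero)
open import Data.Nat.Tactic.RingSolver using (solve)
open import Data.Bool using (true; false) renaming (T to IsTrue)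
open import Data.Fin using (Fin; toℕ; fromℕ<; combine)
open import Data.Fin.Properties using (pigeonhole; combine-injective; fromℕ<-injective)
open import Data.List using (length; filter; map; upTo; applyUpTo; _∷_; [])
open import Data.List.Properties using (map-applyUpTo)
open import Data.Product hiding (swap; map)
open import Data.Sum hiding (map)
open import Data.Sum.Function.Propositional using (_⊎-⇔_)
open import Data.Empty
open import Function using (_∘_; id; flip; mk⇔; Equivalence)
open import Function.Properties.Equivalence using () renaming (trans to ⇔-trans)
open import Relation.Nullary
open import Relation.Nullary.Decidable using (decidable-stable)
open import Relation.Binary.Definitions using (tri<; tri≈; tri>)
open import Relation.Binary.PropositionalEquality hiding ([_])

-- Write the complete quotients of √D as (m_n + √D)/d_n. From n = 1 on the pairs (m_n, d_n) are
-- reduced, and on reduced pairs the step (m, d) ↦ (m', d') is injective: d is recovered from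
-- d d' + m'² = D, and m from m + m' = a d, where a is also the partial quotient of (m', d). So
-- the orbit is purely periodic, d_n = 1 exactly at the multiples of the period T, where a_n = 2a₀,
-- and a_n ≤ a₀ otherwise. Running the recurrences backwards from n = T shows that (m_n, d_n)
-- mirrors to (m_{T+1−n}, d_{T−n}), so a_1, …, a_{T−1} is a palindrome. Hence a occurs an odd
-- number of times iff a = 2a₀ (i.e. a is even and a² < 4D < (a+2)²), or T = 2h is even and
-- a = a_h. At such a centre m_{h+1} = m_h, so 2m_h = a_h d_h and d_{h−1} d_h + m_h² = D; for
-- D = p, and for D = 2p with p odd, this forces d_h = 2, so that a_h = m_h is the number of its
-- parity with a_h² < D < (a_h + 2)². For D = 2p that number is even. For D = p it is odd and
-- p ≡ 3 (mod 4): an odd period writes p as a sum of two squares, and an even period yields a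
-- convergent P/Q with P² − pQ² = ±2, which is impossible modulo 4 when p ≡ 1 (mod 4).

-- Parity and squares modulo 4

Even Odd : ℕ → Set
Even n = ∃[ k ] n ≡ k + k
Odd  n = ∃[ k ] n ≡ suc (k + k)

even-or-odd : ∀ n → Even n ⊎ Odd n
even-or-odd zero = inj₁ (0 , refl)
even-or-odd (suc n) with even-or-odd n
... | inj₁ (k , refl) = inj₂ (k , refl)
... | inj₂ (k , refl) = inj₁ (suc k , cong suc (sym (+-suc k k)))

2*n≡n+n : ∀ n → 2 * n ≡ n + n
2*n≡n+n n = solve (n ∷ [])

n*2≡n+n : ∀ n → n * 2 ≡ n + n
n*2≡n+n n = solve (n ∷ [])

even⇒%2≡0 : ∀ {n} → Even n → n % 2 ≡ 0
even⇒%2≡0 (k , refl) = trans (cong (_% 2) (sym (n*2≡n+n k))) (m*n%n≡0 k 2)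

odd⇒%2≡1 : ∀ {n} → Odd n → n % 2 ≡ 1
odd⇒%2≡1 (k , refl) = trans (cong (λ x → suc x % 2) (sym (n*2≡n+n k))) ([m+kn]%n≡m%n 1 k 2)

even⇒¬odd : ∀ {n} → Even n → ¬ Odd n
even⇒¬odd n-even n-odd = 0≢1+n (trans (sym (even⇒%2≡0 n-even)) (odd⇒%2≡1 n-odd))

%2≡0⇒even : ∀ {n} → n % 2 ≡ 0 → Even n
%2≡0⇒even {n} n%2≡0 = [ id , ⊥-elim ∘ 0≢1+n ∘ trans (sym n%2≡0) ∘ odd⇒%2≡1 ]′ (even-or-odd n)

%2≡1⇒odd : ∀ {n} → n % 2 ≡ 1 → Odd n
%2≡1⇒odd {n} n%2≡1 = [ ⊥-elim ∘ 0≢1+n ∘ sym ∘ trans (sym n%2≡1) ∘ even⇒%2≡0 , id ]′ (even-or-odd n)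

%2≡1⇔odd : ∀ {n} → n % 2 ≡ 1 ⇔ Odd n
%2≡1⇔odd = mk⇔ %2≡1⇒odd odd⇒%2≡1

suc%2≢%2 : ∀ n → suc n % 2 ≢ n % 2
suc%2≢%2 n with even-or-odd n
... | inj₁ (k , refl) = λ 1+n≡n[2] →
  0≢1+n (trans (sym (even⇒%2≡0 (k , refl))) (trans (sym 1+n≡n[2]) (odd⇒%2≡1 (k , refl))))
... | inj₂ (k , refl) = λ 1+n≡n[2] →
  0≢1+n (trans (sym (even⇒%2≡0 (suc k , cong suc (sym (+-suc k k))))) (trans 1+n≡n[2] (odd⇒%2≡1 (k , refl))))

double-injective : ∀ {j k} → j + j ≡ k + k → j ≡ k
double-injective {j} {k} 2j≡2k = *-cancelʳ-≡ j k 2 (trans (n*2≡n+n j) (trans 2j≡2k (sym (n*2≡n+n k))))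

odd*odd⇒odd : ∀ {x y} → Odd x → Odd y → Odd (x * y)
odd*odd⇒odd (s , refl) (t , refl) = s + t + s * t + s * t , solve (s ∷ t ∷ [])

double+odd²-odd : ∀ e {m} → Odd m → Odd (e * 2 + m * m)
double+odd²-odd e (j , refl) = e + j + j + j * j + j * j , solve (e ∷ j ∷ [])

odd⇒%4≡1⊎%4≡3 : ∀ {p} → Odd p → p % 4 ≡ 1 ⊎ p % 4 ≡ 3
odd⇒%4≡1⊎%4≡3 (r , refl) with even-or-odd r
... | inj₁ (k , refl) = inj₁ (trans (cong (_% 4) (≡1+k*4 k)) ([m+kn]%n≡m%n 1 k 4))
  where
  ≡1+k*4 : ∀ k → suc ((k + k) + (k + k)) ≡ 1 + k * 4
  ≡1+k*4 k = solve (k ∷ [])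
... | inj₂ (k , refl) = inj₂ (trans (cong (_% 4) (≡3+k*4 k)) ([m+kn]%n≡m%n 3 k 4))
  where
  ≡3+k*4 : ∀ k → suc (suc (k + k) + suc (k + k)) ≡ 3 + k * 4
  ≡3+k*4 k = solve (k ∷ [])

square%4≡0⊎1 : ∀ x → (x * x) % 4 ≡ 0 ⊎ (x * x) % 4 ≡ 1
square%4≡0⊎1 x = subst (λ s → s ≡ 0 ⊎ s ≡ 1) (sym (%-distribˡ-* x x 4)) (residue (x % 4) (m%n<n x 4))
  where
  residue : ∀ r → r < 4 → (r * r) % 4 ≡ 0 ⊎ (r * r) % 4 ≡ 1
  residue 0 _ = inj₁ refl
  residue 1 _ = inj₂ refl
  residue 2 _ = inj₁ refl
  residue 3 _ = inj₂ refl
  residue (suc (suc (suc (suc _)))) (s≤s (s≤s (s≤s (s≤s ()))))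

sum-of-squares%4≢3 : ∀ x y → (x * x + y * y) % 4 ≢ 3
sum-of-squares%4≢3 x y eq
  with square%4≡0⊎1 x | square%4≡0⊎1 y | trans (sym (%-distribˡ-+ (x * x) (y * y) 4)) eq
... | inj₁ e | inj₁ f | h rewrite e | f with () ← h
... | inj₁ e | inj₂ f | h rewrite e | f with () ← h
... | inj₂ e | inj₁ f | h rewrite e | f with () ← h
... | inj₂ e | inj₂ f | h rewrite e | f with () ← h

square+2%4≢square%4 : ∀ x y → (x * x + 2) % 4 ≢ (y * y) % 4
square+2%4≢square%4 x y eq
  with square%4≡0⊎1 x | square%4≡0⊎1 y | trans (sym (%-distribˡ-+ (x * x) 2 4)) eq
... | inj₁ e | inj₁ f | h rewrite e | f with () ← h
... | inj₁ e | inj₂ f | h rewrite e | f with () ← h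
... | inj₂ e | inj₁ f | h rewrite e | f with () ← h
... | inj₂ e | inj₂ f | h rewrite e | f with () ← h

p*n%4≡n%4 : ∀ {p} n → p % 4 ≡ 1 → (p * n) % 4 ≡ n % 4
p*n%4≡n%4 {p} n p%4≡1 = begin
  (p * n) % 4                  ≡⟨ %-distribˡ-* p n 4 ⟩
  ((p % 4) * (n % 4)) % 4      ≡⟨ cong (λ x → (x * (n % 4)) % 4) p%4≡1 ⟩
  (1 * (n % 4)) % 4            ≡⟨ cong (_% 4) (*-identityˡ (n % 4)) ⟩
  (n % 4) % 4                  ≡⟨ m%n%n≡m%n n 4 ⟩
  n % 4                        ∎
  where open ≡-Reasoning

no-norm-±2 : ∀ {p X Y} → p % 4 ≡ 1 → ¬ (X * X ≡ p * (Y * Y) + 2 ⊎ X * X + 2 ≡ p * (Y * Y))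
no-norm-±2 {p} {X} {Y} p%4≡1 (inj₁ X²≡pY²+2) = square+2%4≢square%4 Y X (begin
  (Y * Y + 2) % 4                ≡⟨ %-distribˡ-+ (Y * Y) 2 4 ⟩
  ((Y * Y) % 4 + 2) % 4          ≡⟨ cong (λ x → (x + 2) % 4) (sym (p*n%4≡n%4 {p} (Y * Y) p%4≡1)) ⟩
  ((p * (Y * Y)) % 4 + 2) % 4    ≡⟨ sym (%-distribˡ-+ (p * (Y * Y)) 2 4) ⟩
  (p * (Y * Y) + 2) % 4          ≡⟨ cong (_% 4) (sym X²≡pY²+2) ⟩
  (X * X) % 4                    ∎)
  where open ≡-Reasoning
no-norm-±2 {p} {X} {Y} p%4≡1 (inj₂ X²+2≡pY²) =
  square+2%4≢square%4 X Y (trans (cong (_% 4) X²+2≡pY²) (p*n%4≡n%4 {p} (Y * Y) p%4≡1))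

-- Divisors at the centre of an even period

odd-coprime-2 : ∀ {n} → Odd n → Coprime n 2
odd-coprime-2 (zero , refl) = 1-coprimeTo 2
odd-coprime-2 (suc k , refl) =
  subst (λ n → Coprime n 2) (cong (suc ∘ suc) (sym (+-suc k k))) (coprime-+ (odd-coprime-2 (k , refl)))

odd∣double⇒∣ : ∀ {t m} → Odd t → t ∣ m + m → t ∣ m
odd∣double⇒∣ {t} {m} t-odd t∣2m = coprime-divisor (odd-coprime-2 t-odd) (subst (t ∣_) (sym (2*n≡n+n m)) t∣2m)

double∣double⇒∣ : ∀ {t m} → t + t ∣ m + m → t ∣ m
double∣double⇒∣ {t} {m} = *-cancelˡ-∣ 2 ∘ subst₂ _∣_ (sym (2*n≡n+n t)) (sym (2*n≡n+n m))

2∣⇒even : ∀ {n} → 2 ∣ n → Even n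
2∣⇒even (divides q n≡q*2) = q , trans n≡q*2 (n*2≡n+n q)

∣d∣m⇒∣d*e+m*m : ∀ {x d e m} → x ∣ d → x ∣ m → x ∣ d * e + m * m
∣d∣m⇒∣d*e+m*m {e = e} {m} x∣d x∣m = ∣m∣n⇒∣m+n (∣m⇒∣m*n e x∣d) (∣m⇒∣m*n m x∣m)

prime>1 : ∀ {p} → Prime p → 1 < p
prime>1 {p} p-prime = nonTrivial⇒n>1 p {{prime⇒nonTrivial p-prime}}

prime⇒nonSquare : ∀ {p} → Prime p → ∀ s → s * s ≢ p
prime⇒nonSquare p-prime s s²≡p with prime⇒irreducible p-prime (divides s (sym s²≡p))
... | inj₁ refl = <⇒≢ (prime>1 p-prime) s²≡p
... | inj₂ refl = <⇒≢ (prime>1 p-prime)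
  (sym (*-cancelˡ-≡ s 1 s {{prime⇒nonZero p-prime}} (trans s²≡p (sym (*-identityʳ s)))))

twice-odd-nonSquare : ∀ {p} → Odd p → ∀ s → s * s ≢ 2 * p
twice-odd-nonSquare {p} p-odd s s²≡2p with even-or-odd s
... | inj₂ s-odd = even⇒¬odd (p , trans s²≡2p (2*n≡n+n p)) (odd*odd⇒odd s-odd s-odd)
... | inj₁ (j , refl) = even⇒¬odd (j * j , double-injective (begin
  p + p                                 ≡⟨ sym (2*n≡n+n p) ⟩
  2 * p                                 ≡⟨ sym s²≡2p ⟩
  (j + j) * (j + j)                     ≡⟨ solve (j ∷ []) ⟩
  (j * j + j * j) + (j * j + j * j)     ∎)) p-odd
  where open ≡-Reasoning

-- d ∣ 2m gives d ∣ m for odd d and t ∣ m for d = 2t; since 0 < m < p, a common divisor of m and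
-- D = p (or an odd one of m and D = 2p) is 1.
centre-denominator-prime : ∀ {p m q d e} → Prime p → 0 < m → m < p →
                           m + m ≡ q * d → d * e + m * m ≡ p → d ≢ 1 → d ≡ 2
centre-denominator-prime {p} {m} {q} {d} p-prime m>0 m<p 2m≡qd norm d≢1 with even-or-odd d
... | inj₂ d-odd = contradiction (prime⇒coprime p-prime {{>-nonZero m>0}} m<p (d∣p , d∣m)) d≢1
  where
  d∣m : d ∣ m
  d∣m = odd∣double⇒∣ d-odd (divides q 2m≡qd)
  d∣p : d ∣ p
  d∣p = subst (d ∣_) norm (∣d∣m⇒∣d*e+m*m ∣-refl d∣m)
... | inj₁ (t , refl) = cong (λ x → x + x) (prime⇒coprime p-prime {{>-nonZero m>0}} m<p (t∣p , t∣m))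
  where
  t∣m : t ∣ m
  t∣m = double∣double⇒∣ (divides q 2m≡qd)
  t∣p : t ∣ p
  t∣p = subst (t ∣_) norm (∣d∣m⇒∣d*e+m*m (∣m∣n⇒∣m+n ∣-refl ∣-refl) t∣m)

centre-denominator-twice-prime : ∀ {p m q d e} → Prime p → Odd p → 0 < m → m < p →
                                 m + m ≡ q * d → d * e + m * m ≡ 2 * p → d ≢ 1 → d ≡ 2
centre-denominator-twice-prime {p} {m} {q} {d} p-prime p-odd m>0 m<p 2m≡qd norm d≢1 with even-or-odd d
... | inj₂ d-odd = contradiction (prime⇒coprime p-prime {{>-nonZero m>0}} m<p (d∣p , d∣m)) d≢1
  where
  d∣m : d ∣ m
  d∣m = odd∣double⇒∣ d-odd (divides q 2m≡qd)
  d∣p : d ∣ p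
  d∣p = coprime-divisor (odd-coprime-2 d-odd) (subst (d ∣_) norm (∣d∣m⇒∣d*e+m*m ∣-refl d∣m))
... | inj₁ (t , refl) with even-or-odd t
...   | inj₂ t-odd = cong (λ x → x + x) (prime⇒coprime p-prime {{>-nonZero m>0}} m<p (t∣p , t∣m))
  where
  t∣m : t ∣ m
  t∣m = double∣double⇒∣ (divides q 2m≡qd)
  t∣p : t ∣ p
  t∣p = coprime-divisor (odd-coprime-2 t-odd)
    (subst (t ∣_) norm (∣d∣m⇒∣d*e+m*m (∣m∣n⇒∣m+n ∣-refl ∣-refl) t∣m))
...   | inj₁ (k , refl) = ⊥-elim (even⇒¬odd (2∣⇒even (*-cancelˡ-∣ 2 4∣2p)) p-odd)
  where
  2∣m : 2 ∣ m
  2∣m = ∣-trans (divides k (sym (n*2≡n+n k))) (double∣double⇒∣ (divides q 2m≡qd))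
  4∣d : 2 * 2 ∣ (k + k) + (k + k)
  4∣d = divides k (solve (k ∷ []))
  4∣2p : 2 * 2 ∣ 2 * p
  4∣2p = subst (2 * 2 ∣_) norm (∣m∣n⇒∣m+n (∣m⇒∣m*n _ 4∣d) (*-pres-∣ 2∣m 2∣m))

prime-centre-odd : ∀ {p e m} → Prime p → 0 < m → m < p → e * 2 + m * m ≡ p → Odd m × Odd p
prime-centre-odd {p} {e} {m} p-prime m>0 m<p norm with even-or-odd m
... | inj₂ m-odd = m-odd , subst Odd norm (double+odd²-odd e m-odd)
... | inj₁ (j , refl) with prime⇒irreducible p-prime 2∣p
  where
  2∣p : 2 ∣ p
  2∣p = divides (e + j * (j + j)) (trans (sym norm) (solve (e ∷ j ∷ [])))
...   | inj₂ refl = ⊥-elim (even⇒¬odd (j , refl) (0 , ≤-antisym (s≤s⁻¹ m<p) m>0))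

twice-centre-even : ∀ {p e m} → e * 2 + m * m ≡ 2 * p → Even m
twice-centre-even {p} {e} {m} norm with even-or-odd m
... | inj₁ m-even = m-even
... | inj₂ m-odd = ⊥-elim (even⇒¬odd (p , trans norm (2*n≡n+n p)) (double+odd²-odd e m-odd))

-- Square roots and reduced quadratic irrationals

isqrt-spec : ∀ n → isqrt n * isqrt n ≤ n × n < suc (isqrt n) * suc (isqrt n)
isqrt-spec zero = z≤n , s≤s z≤n
isqrt-spec (suc n) with isqrt n | isqrt-spec n
... | s | s²≤n , n<[1+s]² with suc s * suc s ≤ᵇ suc n in eq
... | true  = ≤ᵇ⇒≤ (suc s * suc s) (suc n) (subst IsTrue (sym eq) _) ,
              ≤-<-trans n<[1+s]² (*-mono-< (n<1+n (suc s)) (n<1+n (suc s)))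
... | false = m≤n⇒m≤1+n s²≤n , ≰⇒> (subst IsTrue eq ∘ ≤⇒≤ᵇ)

square-mono-≤ : ∀ {x y} → x ≤ y → x * x ≤ y * y
square-mono-≤ x≤y = *-mono-≤ x≤y x≤y

square-cancel-< : ∀ {x y} → x * x < y * y → x < y
square-cancel-< {x} {y} x²<y² with x <? y
... | yes x<y = x<y
... | no x≮y = contradiction (square-mono-≤ (≮⇒≥ x≮y)) (<⇒≱ x²<y²)

square<k*p⇒<p : ∀ {a k p} → a * a < k * p → k ≤ p → a < p
square<k*p⇒<p {a} {k} {p} a²<kp k≤p with a <? p
... | yes a<p = a<p
... | no a≮p = contradiction (≤-trans (*-monoˡ-≤ p k≤p) (square-mono-≤ (≮⇒≥ a≮p))) (<⇒≱ a²<kp)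

<∧<+2⇒≡suc : ∀ {u v} → u < v → v < u + 2 → suc u ≡ v
<∧<+2⇒≡suc {u} {v} u<v v<u+2 = ≤-antisym u<v (s≤s⁻¹ (subst (v <_) (+-comm u 2) v<u+2))

≢1⇒≥2 : ∀ {x} → 0 < x → x ≢ 1 → 2 ≤ x
≢1⇒≥2 {suc zero} _ x≢1 = contradiction refl x≢1
≢1⇒≥2 {suc (suc _)} _ _ = s≤s (s≤s z≤n)

divN≡/ : ∀ x d .{{_ : NonZero d}} → divN x d ≡ x / d
divN≡/ x (suc k) = refl

/-unique : ∀ {x r q} d .{{_ : NonZero d}} → x ≡ r + q * d → r < d → x / d ≡ q
/-unique {r = r} {q} d refl r<d =
  trans (+-distrib-/-∣ʳ r (divides-refl q)) (cong₂ _+_ (m<n⇒m/n≡0 r<d) (m*n/n≡m q d))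

-- D − m'² ≡ D − m² (mod d) because m' ≡ −m (mod d).
conjugate-norm-divisible : ∀ {D d e m m' q} → d * e + m * m ≡ D → m' + m ≡ q * d →
                           m' * m' ≤ D → d ∣ D ∸ m' * m'
conjugate-norm-divisible {D} {d} {e} {m} {m'} {q} norm m'+m≡qd m'²≤D =
  ∣m+n∣m⇒∣n (divides (m * q + e) (+-cancelʳ-≡ (m' * m') _ _ shifted)) (n∣m*n (m' * q))
  where
  open ≡-Reasoning
  shifted : m' * q * d + (D ∸ m' * m') + m' * m' ≡ (m * q + e) * d + m' * m'
  shifted = begin
    m' * q * d + (D ∸ m' * m') + m' * m'   ≡⟨ +-assoc (m' * q * d) _ _ ⟩
    m' * q * d + (D ∸ m' * m' + m' * m')   ≡⟨ cong (m' * q * d +_) (m∸n+n≡m m'²≤D) ⟩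
    m' * q * d + D                         ≡⟨ cong (m' * q * d +_) (sym norm) ⟩
    m' * q * d + (d * e + m * m)           ≡⟨ solve (m' ∷ q ∷ d ∷ e ∷ m ∷ []) ⟩
    m' * (q * d) + d * e + m * m           ≡⟨ cong (λ x → m' * x + d * e + m * m) (sym m'+m≡qd) ⟩
    m' * (m' + m) + d * e + m * m          ≡⟨ solve (m' ∷ m ∷ d ∷ e ∷ []) ⟩
    m * (m' + m) + d * e + m' * m'         ≡⟨ cong (λ x → m * x + d * e + m' * m') m'+m≡qd ⟩
    m * (q * d) + d * e + m' * m'          ≡⟨ solve (m ∷ q ∷ d ∷ e ∷ m' ∷ []) ⟩
    (m * q + e) * d + m' * m'              ∎

cofactor-lower : ∀ {a₀ D m d d'} → a₀ * a₀ < D → d * d' + m * m ≡ D →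
                 d ≤ a₀ + m → a₀ < m + d'
cofactor-lower {a₀} {D} {m} {d} {d'} a₀²<D norm d≤a₀+m with a₀ <? m + d'
... | yes a₀<m+d' = a₀<m+d'
... | no a₀≮m+d' = contradiction D≤a₀² (<⇒≱ a₀²<D)
  where
  open ≤-Reasoning
  d'+m≤a₀ : d' + m ≤ a₀
  d'+m≤a₀ = subst (_≤ a₀) (+-comm m d') (≮⇒≥ a₀≮m+d')
  D≤a₀² : D ≤ a₀ * a₀
  D≤a₀² = begin
    D                         ≡⟨ sym norm ⟩
    d * d' + m * m            ≤⟨ +-monoˡ-≤ (m * m) (*-monoˡ-≤ d' d≤a₀+m) ⟩
    (a₀ + m) * d' + m * m     ≡⟨ solve (a₀ ∷ m ∷ d' ∷ []) ⟩
    a₀ * d' + m * (d' + m)    ≤⟨ +-monoʳ-≤ (a₀ * d') (*-monoʳ-≤ m d'+m≤a₀) ⟩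
    a₀ * d' + m * a₀          ≡⟨ solve (a₀ ∷ m ∷ d' ∷ []) ⟩
    a₀ * (d' + m)             ≤⟨ *-monoʳ-≤ a₀ d'+m≤a₀ ⟩
    a₀ * a₀                   ∎

cofactor-upper : ∀ {a₀ D m d d'} → D < suc a₀ * suc a₀ → d * d' + m * m ≡ D →
                 a₀ < m + d → d' ≤ a₀ + m
cofactor-upper {a₀} {D} {m} {d} {d'} D<[1+a₀]² norm a₀<m+d with d' ≤? a₀ + m
... | yes d'≤a₀+m = d'≤a₀+m
... | no d'≰a₀+m =
  contradiction (square≤D (subst (suc a₀ ≤_) (+-comm m d) a₀<m+d) (≰⇒> d'≰a₀+m)) (<⇒≱ D<[1+a₀]²)
  where
  open ≤-Reasoning
  square≤D : ∀ {u} → u ≤ d + m → u + m ≤ d' → u * u ≤ D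
  square≤D {u} u≤d+m u+m≤d' = +-cancelʳ-≤ (u * m) (u * u) _ (begin
    u * u + u * m                  ≡⟨ solve (u ∷ m ∷ []) ⟩
    u * (u + m)                    ≤⟨ *-monoˡ-≤ (u + m) u≤d+m ⟩
    (d + m) * (u + m)              ≡⟨ solve (d ∷ m ∷ u ∷ []) ⟩
    d * (u + m) + m * m + u * m    ≤⟨ +-monoˡ-≤ (u * m) (+-monoˡ-≤ (m * m) (*-monoʳ-≤ d u+m≤d')) ⟩
    d * d' + m * m + u * m         ≡⟨ cong (_+ u * m) norm ⟩
    D + u * m                      ∎)

-- Convergents

-- √D = (P x + P')/(Q x + Q') for the complete quotient x = (m + √D)/d, cleared of √D and of
-- denominators; P/Q and P'/Q' are consecutive convergents.
record Convergents (D m d P Q P' Q' : ℕ) : Set where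
  field
    numerator  : P ≡ m * Q + d * Q'
    conjugate  : d * P' + m * P ≡ D * Q
    unimodular : P * Q' ≡ P' * Q + 1 ⊎ P' * Q ≡ P * Q' + 1

convergents-next : ∀ {D a m d m' d' P Q P' Q'} .{{_ : NonZero d}} →
                   m' + m ≡ a * d → d * d' + m' * m' ≡ D → Convergents D m d P Q P' Q' →
                   Convergents D m' d' (a * P + P') (a * Q + Q') P Q
convergents-next {D} {a} {m} {d} {m'} {d'} {P} {Q} {P'} {Q'} m'+m≡ad norm c = record
  { numerator = *-cancelˡ-≡ _ _ d d*numerator
  ; conjugate = *-cancelˡ-≡ _ _ d d*conjugate
  ; unimodular = [ inj₂ ∘ flip₁ , inj₁ ∘ flip₂ ] unimodular
  }
  where
  open ≡-Reasoning
  open Convergents c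
  d*P⁺ : d * (a * P + P') ≡ m' * P + D * Q
  d*P⁺ = +-cancelʳ-≡ (m * P) _ _ (begin
    d * (a * P + P') + m * P        ≡⟨ solve (d ∷ a ∷ P ∷ P' ∷ m ∷ []) ⟩
    (a * d) * P + (d * P' + m * P)  ≡⟨ cong₂ (λ x y → x * P + y) (sym m'+m≡ad) conjugate ⟩
    (m' + m) * P + D * Q            ≡⟨ solve (m' ∷ m ∷ P ∷ D ∷ Q ∷ []) ⟩
    m' * P + D * Q + m * P          ∎)
  d*numerator : d * (a * P + P') ≡ d * (m' * (a * Q + Q') + d' * Q)
  d*numerator = trans d*P⁺ (sym (+-cancelʳ-≡ (m' * m' * Q) _ _ (begin
    d * (m' * (a * Q + Q') + d' * Q) + m' * m' * Q
      ≡⟨ solve (d ∷ m' ∷ a ∷ Q ∷ Q' ∷ d' ∷ []) ⟩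
    m' * (a * d) * Q + m' * d * Q' + (d * d' + m' * m') * Q
      ≡⟨ cong₂ (λ x y → m' * x * Q + m' * d * Q' + y * Q) (sym m'+m≡ad) norm ⟩
    m' * (m' + m) * Q + m' * d * Q' + D * Q
      ≡⟨ solve (m' ∷ m ∷ Q ∷ d ∷ Q' ∷ D ∷ []) ⟩
    m' * (m * Q + d * Q') + D * Q + m' * m' * Q
      ≡⟨ cong (λ x → m' * x + D * Q + m' * m' * Q) (sym numerator) ⟩
    m' * P + D * Q + m' * m' * Q    ∎)))
  d*conjugate : d * (d' * P + m' * (a * P + P')) ≡ d * (D * (a * Q + Q'))
  d*conjugate = begin
    d * (d' * P + m' * (a * P + P'))         ≡⟨ solve (d ∷ d' ∷ P ∷ m' ∷ a ∷ P' ∷ []) ⟩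
    (d * d') * P + m' * (d * (a * P + P'))   ≡⟨ cong (λ x → (d * d') * P + m' * x) d*P⁺ ⟩
    (d * d') * P + m' * (m' * P + D * Q)     ≡⟨ solve (d ∷ d' ∷ P ∷ m' ∷ D ∷ Q ∷ []) ⟩
    (d * d' + m' * m') * P + m' * (D * Q)    ≡⟨ cong (λ x → x * P + m' * (D * Q)) norm ⟩
    D * P + m' * (D * Q)                     ≡⟨ cong (λ x → D * x + m' * (D * Q)) numerator ⟩
    D * (m * Q + d * Q') + m' * (D * Q)      ≡⟨ solve (D ∷ m ∷ Q ∷ d ∷ Q' ∷ m' ∷ []) ⟩
    D * ((m' + m) * Q + d * Q')              ≡⟨ cong (λ x → D * (x * Q + d * Q')) m'+m≡ad ⟩
    D * ((a * d) * Q + d * Q')               ≡⟨ solve (D ∷ a ∷ d ∷ Q ∷ Q' ∷ []) ⟩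
    d * (D * (a * Q + Q'))                   ∎
  flip₁ : P * Q' ≡ P' * Q + 1 → P * (a * Q + Q') ≡ (a * P + P') * Q + 1
  flip₁ PQ'≡P'Q+1 = begin
    P * (a * Q + Q')          ≡⟨ solve (P ∷ a ∷ Q ∷ Q' ∷ []) ⟩
    a * P * Q + P * Q'        ≡⟨ cong (a * P * Q +_) PQ'≡P'Q+1 ⟩
    a * P * Q + (P' * Q + 1)  ≡⟨ solve (a ∷ P ∷ Q ∷ P' ∷ []) ⟩
    (a * P + P') * Q + 1      ∎
  flip₂ : P' * Q ≡ P * Q' + 1 → (a * P + P') * Q ≡ P * (a * Q + Q') + 1
  flip₂ P'Q≡PQ'+1 = begin
    (a * P + P') * Q          ≡⟨ solve (a ∷ P ∷ P' ∷ Q ∷ []) ⟩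
    a * P * Q + P' * Q        ≡⟨ cong (a * P * Q +_) P'Q≡PQ'+1 ⟩
    a * P * Q + (P * Q' + 1)  ≡⟨ solve (a ∷ P ∷ Q ∷ Q' ∷ []) ⟩
    P * (a * Q + Q') + 1      ∎

convergents-norm : ∀ {D m d P Q P' Q'} → Convergents D m d P Q P' Q' →
                   P * P ≡ D * (Q * Q) + d ⊎ P * P + d ≡ D * (Q * Q)
convergents-norm {D} {m} {d} {P} {Q} {P'} {Q'} c = [ inj₁ ∘ case₁ , inj₂ ∘ case₂ ] unimodular
  where
  open ≡-Reasoning
  open Convergents c
  key : P * P + d * (P' * Q) ≡ D * (Q * Q) + d * (P * Q')
  key = begin
    P * P + d * (P' * Q)                 ≡⟨ cong (λ x → P * x + d * (P' * Q)) numerator ⟩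
    P * (m * Q + d * Q') + d * (P' * Q)  ≡⟨ solve (P ∷ m ∷ Q ∷ d ∷ Q' ∷ P' ∷ []) ⟩
    (d * P' + m * P) * Q + d * (P * Q')  ≡⟨ cong (λ x → x * Q + d * (P * Q')) conjugate ⟩
    D * Q * Q + d * (P * Q')             ≡⟨ cong (_+ d * (P * Q')) (*-assoc D Q Q) ⟩
    D * (Q * Q) + d * (P * Q')           ∎
  case₁ : P * Q' ≡ P' * Q + 1 → P * P ≡ D * (Q * Q) + d
  case₁ PQ'≡P'Q+1 = +-cancelʳ-≡ (d * (P' * Q)) _ _ (begin
    P * P + d * (P' * Q)                 ≡⟨ key ⟩
    D * (Q * Q) + d * (P * Q')           ≡⟨ cong (λ x → D * (Q * Q) + d * x) PQ'≡P'Q+1 ⟩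
    D * (Q * Q) + d * (P' * Q + 1)       ≡⟨ solve (D ∷ Q ∷ d ∷ P' ∷ []) ⟩
    D * (Q * Q) + d + d * (P' * Q)       ∎)
  case₂ : P' * Q ≡ P * Q' + 1 → P * P + d ≡ D * (Q * Q)
  case₂ P'Q≡PQ'+1 = +-cancelʳ-≡ (d * (P * Q')) _ _ (begin
    P * P + d + d * (P * Q')             ≡⟨ solve (P ∷ d ∷ Q' ∷ []) ⟩
    P * P + d * (P * Q' + 1)             ≡⟨ cong (λ x → P * P + d * x) (sym P'Q≡PQ'+1) ⟩
    P * P + d * (P' * Q)                 ≡⟨ key ⟩
    D * (Q * Q) + d * (P * Q')           ∎)

-- Palindromic sums

sumUpTo : (ℕ → ℕ) → ℕ → ℕ
sumUpTo f zero = 0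
sumUpTo f (suc n) = f 0 + sumUpTo (f ∘ suc) n

sumUpTo-suc : ∀ f n → sumUpTo f (suc n) ≡ sumUpTo f n + f n
sumUpTo-suc f zero = +-identityʳ (f 0)
sumUpTo-suc f (suc n) = trans (cong (f 0 +_) (sumUpTo-suc (f ∘ suc) n)) (sym (+-assoc (f 0) _ _))

sumUpTo-peel : ∀ f n → f (suc n) ≡ f 0 → sumUpTo f (suc (suc n)) ≡ f 0 + f 0 + sumUpTo (f ∘ suc) n
sumUpTo-peel f n last≡first = begin
  f 0 + sumUpTo (f ∘ suc) (suc n)           ≡⟨ cong (f 0 +_) (sumUpTo-suc (f ∘ suc) n) ⟩
  f 0 + (sumUpTo (f ∘ suc) n + f (suc n))   ≡⟨ cong (λ x → f 0 + (sumUpTo (f ∘ suc) n + x)) last≡first ⟩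
  f 0 + (sumUpTo (f ∘ suc) n + f 0)         ≡⟨ regroup (f 0) _ ⟩
  f 0 + f 0 + sumUpTo (f ∘ suc) n           ∎
  where
  open ≡-Reasoning
  regroup : ∀ x s → x + (s + x) ≡ x + x + s
  regroup x s = solve (x ∷ s ∷ [])

Palindromic : (ℕ → ℕ) → ℕ → Set
Palindromic f n = ∀ i j → suc (i + j) ≡ n → f i ≡ f j

-- The terms f i and f (n − 1 − i) pair up; only a middle term can be left over.
palindromic-sum : ∀ n f → Palindromic f n →
                  (Even n × Even (sumUpTo f n)) ⊎ ∃[ h ] n ≡ suc (h + h) × ∃[ k ] sumUpTo f n ≡ k + k + f h
palindromic-sum zero f _ = inj₁ ((0 , refl) , (0 , refl))
palindromic-sum (suc zero) f _ = inj₂ (0 , refl , 0 , +-identityʳ (f 0))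
palindromic-sum (suc (suc n)) f pal with palindromic-sum n (f ∘ suc) inner-pal
  where
  inner-pal : Palindromic (f ∘ suc) n
  inner-pal i j i+j+1≡n = pal (suc i) (suc j) (cong (suc ∘ suc) (trans (+-suc i j) i+j+1≡n))
... | inj₁ ((h , n≡2h) , (k , s≡2k)) = inj₁ (n+2-even , f 0 + k , sum-even)
  where
  open ≡-Reasoning
  n+2-even : Even (suc (suc n))
  n+2-even = suc h , trans (cong (suc ∘ suc) n≡2h) (cong suc (sym (+-suc h h)))
  sum-even : sumUpTo f (suc (suc n)) ≡ (f 0 + k) + (f 0 + k)
  sum-even = begin
    sumUpTo f (suc (suc n))            ≡⟨ sumUpTo-peel f n (pal (suc n) 0 (cong suc (+-identityʳ _))) ⟩
    f 0 + f 0 + sumUpTo (f ∘ suc) n    ≡⟨ cong (f 0 + f 0 +_) s≡2k ⟩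
    f 0 + f 0 + (k + k)                ≡⟨ regroup (f 0) k ⟩
    (f 0 + k) + (f 0 + k)              ∎
    where
    regroup : ∀ x k → x + x + (k + k) ≡ (x + k) + (x + k)
    regroup x k = solve (x ∷ k ∷ [])
... | inj₂ (h , n≡2h+1 , k , s≡2k+f[1+h]) = inj₂ (suc h , n+2≡2h+3 , f 0 + k , sum-odd)
  where
  open ≡-Reasoning
  n+2≡2h+3 : suc (suc n) ≡ suc (suc h + suc h)
  n+2≡2h+3 = trans (cong (suc ∘ suc) n≡2h+1) (cong (suc ∘ suc) (sym (+-suc h h)))
  sum-odd : sumUpTo f (suc (suc n)) ≡ (f 0 + k) + (f 0 + k) + f (suc h)
  sum-odd = begin
    sumUpTo f (suc (suc n))            ≡⟨ sumUpTo-peel f n (pal (suc n) 0 (cong suc (+-identityʳ _))) ⟩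
    f 0 + f 0 + sumUpTo (f ∘ suc) n    ≡⟨ cong (f 0 + f 0 +_) s≡2k+f[1+h] ⟩
    f 0 + f 0 + (k + k + f (suc h))    ≡⟨ regroup (f 0) k _ ⟩
    (f 0 + k) + (f 0 + k) + f (suc h)  ∎
    where
    regroup : ∀ x k m → x + x + (k + k + m) ≡ (x + k) + (x + k) + m
    regroup x k m = solve (x ∷ k ∷ m ∷ [])

indicator : ∀ {A : Set} → Dec A → ℕ
indicator (yes _) = 1
indicator (no _)  = 0

length-filter-applyUpTo : ∀ {P : ℕ → Set} (P? : ∀ x → Dec (P x)) f n →
                          length (filter P? (applyUpTo f n)) ≡ sumUpTo (indicator ∘ P? ∘ f) n
length-filter-applyUpTo P? f zero = refl
length-filter-applyUpTo P? f (suc n) with P? (f 0)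
... | yes _ = cong suc (length-filter-applyUpTo P? (f ∘ suc) n)
... | no _  = length-filter-applyUpTo P? (f ∘ suc) n

odd-double+indicator⇔ : ∀ {A : Set} {x} k (A? : Dec A) → x ≡ k + k + indicator A? → Odd x ⇔ A
odd-double+indicator⇔ k (yes a) refl = mk⇔ (λ _ → a) (λ _ → k , +-comm (k + k) 1)
odd-double+indicator⇔ k (no ¬a) refl = mk⇔ (⊥-elim ∘ even⇒¬odd (k , +-identityʳ (k + k))) (⊥-elim ∘ ¬a)

odd-double+indicators⇔ : ∀ {A B : Set} {x} k (A? : Dec A) (B? : Dec B) → ¬ (A × B) →
                         x ≡ k + k + indicator A? + indicator B? → Odd x ⇔ (A ⊎ B)
odd-double+indicators⇔ k (yes a) (yes b) ¬a×b _ = ⊥-elim (¬a×b (a , b))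
odd-double+indicators⇔ k (yes a) (no _) _ refl =
  mk⇔ (λ _ → inj₁ a) (λ _ → k , trans (+-identityʳ _) (+-comm (k + k) 1))
odd-double+indicators⇔ k (no _) (yes b) _ refl =
  mk⇔ (λ _ → inj₂ b) (λ _ → k , trans (cong (_+ 1) (+-identityʳ _)) (+-comm (k + k) 1))
odd-double+indicators⇔ k (no ¬a) (no ¬b) _ refl =
  mk⇔ (⊥-elim ∘ even⇒¬odd (k , trans (+-identityʳ _) (+-identityʳ _))) [ ⊥-elim ∘ ¬a , ⊥-elim ∘ ¬b ]

-- The continued fraction of √D

module ContinuedFraction (D : ℕ) (nonSquare : ∀ s → s * s ≢ D) where

  a₀ : ℕ
  a₀ = isqrt D

  a₀²<D : a₀ * a₀ < D
  a₀²<D = ≤∧≢⇒< (proj₁ (isqrt-spec D)) (nonSquare a₀)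

  D<[1+a₀]² : D < suc a₀ * suc a₀
  D<[1+a₀]² = proj₂ (isqrt-spec D)

  a₀>0 : 0 < a₀
  a₀>0 with a₀ | a₀²<D | D<[1+a₀]²
  ... | zero  | 0<D | s≤s D≤0 = contradiction D≤0 (<⇒≱ 0<D)
  ... | suc _ | _   | _       = z<s

  a₀<2a₀ : a₀ < a₀ + a₀
  a₀<2a₀ = subst (_< a₀ + a₀) (+-identityʳ a₀) (+-monoʳ-< a₀ a₀>0)

  isqrt-unique : ∀ {k} → k * k ≤ D → D < suc k * suc k → k ≡ a₀
  isqrt-unique k²≤D D<[1+k]² = ≤-antisym
    (s≤s⁻¹ (square-cancel-< (≤-<-trans k²≤D D<[1+a₀]²)))
    (s≤s⁻¹ (square-cancel-< (≤-<-trans (<⇒≤ a₀²<D) D<[1+k]²)))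

  twice-a₀⇔ : ∀ {a} → a ≡ a₀ + a₀ ⇔ (a % 2 ≡ 0 × a * a < 4 * D × 4 * D < (a + 2) * (a + 2))
  twice-a₀⇔ {a} = mk⇔ to from
    where
    [k+k]²≡4k² : ∀ k → (k + k) * (k + k) ≡ 4 * (k * k)
    [k+k]²≡4k² k = solve (k ∷ [])
    [k+k+2]²≡4[1+k]² : ∀ k → (k + k + 2) * (k + k + 2) ≡ 4 * (suc k * suc k)
    [k+k+2]²≡4[1+k]² k = solve (k ∷ [])
    to : a ≡ a₀ + a₀ → a % 2 ≡ 0 × a * a < 4 * D × 4 * D < (a + 2) * (a + 2)
    to refl = even⇒%2≡0 (a₀ , refl) ,
              subst (_< 4 * D) (sym ([k+k]²≡4k² a₀)) (*-monoʳ-< 4 a₀²<D) ,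
              subst (4 * D <_) (sym ([k+k+2]²≡4[1+k]² a₀)) (*-monoʳ-< 4 D<[1+a₀]²)
    from : a % 2 ≡ 0 × a * a < 4 * D × 4 * D < (a + 2) * (a + 2) → a ≡ a₀ + a₀
    from (a%2≡0 , lower , upper) with %2≡0⇒even {a} a%2≡0
    ... | k , refl = cong (λ x → x + x) (isqrt-unique {k}
      (<⇒≤ (*-cancelˡ-< 4 _ _ (subst (_< 4 * D) ([k+k]²≡4k² k) lower)))
      (*-cancelˡ-< 4 _ _ (subst (4 * D <_) ([k+k+2]²≡4[1+k]² k) upper)))

  Window : ℕ → Set
  Window x = x ≤ a₀ × a₀ < x + 2

  window⇔ : ∀ {x} → Window x ⇔ (x * x < D × D < (x + 2) * (x + 2))
  window⇔ = mk⇔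
    (λ (x≤a₀ , a₀<x+2) → ≤-<-trans (square-mono-≤ x≤a₀) a₀²<D ,
                         <-≤-trans D<[1+a₀]² (square-mono-≤ a₀<x+2))
    (λ (x²<D , D<[x+2]²) → s≤s⁻¹ (square-cancel-< (<-trans x²<D D<[1+a₀]²)) ,
                           square-cancel-< (≤-<-trans (<⇒≤ a₀²<D) D<[x+2]²))

  window-unique : ∀ {x y} → x % 2 ≡ y % 2 → Window x → Window y → x ≡ y
  window-unique {x} {y} x≡y[2] (x≤a₀ , a₀<x+2) (y≤a₀ , a₀<y+2) with <-cmp x y
  ... | tri≈ _ x≡y _ = x≡y
  ... | tri< x<y _ _ =
    contradiction (trans (cong (_% 2) (<∧<+2⇒≡suc x<y (≤-<-trans y≤a₀ a₀<x+2))) (sym x≡y[2])) (suc%2≢%2 x)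
  ... | tri> _ _ y<x =
    contradiction (trans (cong (_% 2) (<∧<+2⇒≡suc y<x (≤-<-trans x≤a₀ a₀<y+2))) x≡y[2]) (suc%2≢%2 y)

  -- (m + √D)/d is reduced: 0 < √D − m < d < √D + m.
  record Reduced (m d : ℕ) : Set where
    field
      m≤a₀     : m ≤ a₀
      a₀<m+d   : a₀ < m + d
      d≤a₀+m   : d ≤ a₀ + m
      cofactor : ℕ
      norm     : d * cofactor + m * m ≡ D

  Reduced⇒d>0 : ∀ {m d} → Reduced m d → 0 < d
  Reduced⇒d>0 {m} {zero} r =
    contradiction (Reduced.m≤a₀ r) (<⇒≱ (subst (a₀ <_) (+-identityʳ m) (Reduced.a₀<m+d r)))
  Reduced⇒d>0 {d = suc _} r = z<s

  Reduced⇒m>0 : ∀ {m d} → Reduced m d → 0 < m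
  Reduced⇒m>0 {zero} {d} r =
    contradiction (subst (d ≤_) (+-identityʳ a₀) (Reduced.d≤a₀+m r)) (<⇒≱ (Reduced.a₀<m+d r))
  Reduced⇒m>0 {suc _} r = z<s

  partialQuotient nextM nextD : ℕ → ℕ → ℕ
  partialQuotient m d = divN (a₀ + m) d
  nextM m d = partialQuotient m d * d ∸ m
  nextD m d = divN (D ∸ nextM m d * nextM m d) d

  next : ℕ × ℕ → ℕ × ℕ
  next (m , d) = nextM m d , nextD m d

  module Step {m d : ℕ} (r : Reduced m d) where
    open Reduced r

    instance
      d≢0 : NonZero d
      d≢0 = >-nonZero (Reduced⇒d>0 r)

    private
      q  = partialQuotient m d
      m' = nextM m d
      d' = nextD m d

      q≡[a₀+m]/d : q ≡ (a₀ + m) / d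
      q≡[a₀+m]/d = divN≡/ (a₀ + m) d

    q*d≤a₀+m : q * d ≤ a₀ + m
    q*d≤a₀+m = subst (λ x → x * d ≤ a₀ + m) (sym q≡[a₀+m]/d) (m/n*n≤m (a₀ + m) d)

    a₀+m<d+q*d : a₀ + m < d + q * d
    a₀+m<d+q*d = begin-strict
      a₀ + m                               ≡⟨ m≡m%n+[m/n]*n (a₀ + m) d ⟩
      (a₀ + m) % d + (a₀ + m) / d * d      <⟨ +-monoˡ-< _ (m%n<n (a₀ + m) d) ⟩
      d + (a₀ + m) / d * d                 ≡⟨ cong (λ x → d + x * d) (sym q≡[a₀+m]/d) ⟩
      d + q * d                            ∎
      where open ≤-Reasoning

    partialQuotient>0 : 0 < q
    partialQuotient>0 = subst (0 <_) (sym q≡[a₀+m]/d) (m≥n⇒m/n>0 d≤a₀+m)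

    d≤q*d : d ≤ q * d
    d≤q*d = m≤n*m d q {{>-nonZero partialQuotient>0}}

    m≤q*d : m ≤ q * d
    m≤q*d with m ≤? q * d
    ... | yes m≤qd = m≤qd
    ... | no m≰qd = ⊥-elim (<-asym (<-≤-trans (≤-<-trans d≤q*d qd<m) m≤a₀) a₀<d)
      where
      qd<m : q * d < m
      qd<m = ≰⇒> m≰qd
      a₀<d : a₀ < d
      a₀<d = +-cancelʳ-< m a₀ d (<-trans a₀+m<d+q*d (+-monoʳ-< d qd<m))

    m'+m≡q*d : m' + m ≡ q * d
    m'+m≡q*d = m∸n+n≡m m≤q*d

    m'≤a₀ : m' ≤ a₀
    m'≤a₀ = +-cancelʳ-≤ m m' a₀ (subst (_≤ a₀ + m) (sym m'+m≡q*d) q*d≤a₀+m)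

    a₀<m'+d : a₀ < m' + d
    a₀<m'+d = +-cancelʳ-< m a₀ (m' + d) (begin-strict
      a₀ + m          <⟨ a₀+m<d+q*d ⟩
      d + q * d       ≡⟨ cong (d +_) (sym m'+m≡q*d) ⟩
      d + (m' + m)    ≡⟨ trans (sym (+-assoc d m' m)) (cong (_+ m) (+-comm d m')) ⟩
      m' + d + m      ∎)
      where open ≤-Reasoning

    d≤a₀+m' : d ≤ a₀ + m'
    d≤a₀+m' = +-cancelʳ-≤ m d (a₀ + m') (begin
      d + m           ≤⟨ +-mono-≤ d≤q*d m≤a₀ ⟩
      q * d + a₀      ≡⟨ cong (_+ a₀) (sym m'+m≡q*d) ⟩
      m' + m + a₀     ≡⟨ trans (+-comm (m' + m) a₀) (sym (+-assoc a₀ m' m)) ⟩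
      a₀ + m' + m     ∎)
      where open ≤-Reasoning

    d*d'+m'²≡D : d * d' + m' * m' ≡ D
    d*d'+m'²≡D = begin
      d * d' + m' * m'                     ≡⟨ cong (λ x → d * x + m' * m') (divN≡/ (D ∸ m' * m') d) ⟩
      d * ((D ∸ m' * m') / d) + m' * m'    ≡⟨ cong (_+ m' * m') (*-comm d _) ⟩
      (D ∸ m' * m') / d * d + m' * m'      ≡⟨ cong (_+ m' * m') (m/n*n≡m d∣D∸m'²) ⟩
      D ∸ m' * m' + m' * m'                ≡⟨ m∸n+n≡m m'²≤D ⟩
      D                                    ∎
      where
      open ≡-Reasoning
      m'²≤D : m' * m' ≤ D
      m'²≤D = ≤-trans (square-mono-≤ m'≤a₀) (<⇒≤ a₀²<D)
      d∣D∸m'² : d ∣ D ∸ m' * m'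
      d∣D∸m'² = conjugate-norm-divisible {m' = m'} {q = q} norm m'+m≡q*d m'²≤D

    reduced-next : Reduced m' d'
    reduced-next = record
      { m≤a₀ = m'≤a₀
      ; a₀<m+d = cofactor-lower a₀²<D d*d'+m'²≡D d≤a₀+m'
      ; d≤a₀+m = cofactor-upper D<[1+a₀]² d*d'+m'²≡D a₀<m'+d
      ; cofactor = d
      ; norm = trans (cong (_+ m' * m') (*-comm d' d)) d*d'+m'²≡D
      }

    partialQuotient-nextM : partialQuotient m' d ≡ q
    partialQuotient-nextM =
      trans (divN≡/ (a₀ + m') d) (/-unique d a₀+m'≡ (m<n+o⇒m∸n<o a₀ m a₀<m+d))
      where
      open ≡-Reasoning
      a₀+m'≡ : a₀ + m' ≡ (a₀ ∸ m) + q * d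
      a₀+m'≡ = begin
        a₀ + m'               ≡⟨ cong (_+ m') (sym (m∸n+n≡m m≤a₀)) ⟩
        (a₀ ∸ m) + m + m'     ≡⟨ +-assoc (a₀ ∸ m) m m' ⟩
        (a₀ ∸ m) + (m + m')   ≡⟨ cong ((a₀ ∸ m) +_) (trans (+-comm m m') m'+m≡q*d) ⟩
        (a₀ ∸ m) + q * d      ∎

    nextM-involutive : nextM m' d ≡ m
    nextM-involutive = begin
      partialQuotient m' d * d ∸ m'    ≡⟨ cong (λ x → x * d ∸ m') partialQuotient-nextM ⟩
      q * d ∸ m'                       ≡⟨ cong (_∸ m') (sym m'+m≡q*d) ⟩
      m' + m ∸ m'                      ≡⟨ m+n∸m≡n m' m ⟩
      m                                ∎
      where open ≡-Reasoning

    partialQuotient≤a₀ : 2 ≤ d → q ≤ a₀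
    partialQuotient≤a₀ 2≤d = *-cancelʳ-≤ q a₀ 2 (begin
      q * 2          ≤⟨ *-monoʳ-≤ q 2≤d ⟩
      q * d          ≤⟨ q*d≤a₀+m ⟩
      a₀ + m         ≤⟨ +-monoʳ-≤ a₀ m≤a₀ ⟩
      a₀ + a₀        ≡⟨ sym (n*2≡n+n a₀) ⟩
      a₀ * 2         ∎)
      where open ≤-Reasoning

  -- d is recovered from d d' + m'² = D, and then m = nextM m' d.
  next-injective : ∀ {m₁ d₁ m₂ d₂} → Reduced m₁ d₁ → Reduced m₂ d₂ →
                   next (m₁ , d₁) ≡ next (m₂ , d₂) → (m₁ , d₁) ≡ (m₂ , d₂)
  next-injective {m₁} {d₁} {m₂} {d₂} r₁ r₂ eq with d₁≡d₂
    where
    m' = nextM m₁ d₁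
    d' = nextD m₁ d₁
    d₁≡d₂ : d₁ ≡ d₂
    d₁≡d₂ = *-cancelʳ-≡ d₁ d₂ d' {{>-nonZero (Reduced⇒d>0 (Step.reduced-next r₁))}}
      (+-cancelʳ-≡ (m' * m') _ _ (trans (Step.d*d'+m'²≡D r₁)
        (sym (subst (λ s → d₂ * proj₂ s + proj₁ s * proj₁ s ≡ D) (sym eq) (Step.d*d'+m'²≡D r₂)))))
  ... | refl = cong (_, d₁) (begin
    m₁                         ≡⟨ sym (Step.nextM-involutive r₁) ⟩
    nextM (nextM m₁ d₁) d₁     ≡⟨ cong (λ x → nextM x d₁) (cong proj₁ eq) ⟩
    nextM (nextM m₂ d₁) d₁     ≡⟨ Step.nextM-involutive r₂ ⟩
    m₂                         ∎)
    where open ≡-Reasoning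

  m[_] d[_] a[_] : ℕ → ℕ
  m[ n ] = proj₁ (state D n)
  d[ n ] = proj₂ (state D n)
  a[ n ] = cf D n

  reduced-a₀-1 : Reduced a₀ 1
  reduced-a₀-1 = record
    { m≤a₀ = ≤-refl
    ; a₀<m+d = subst (a₀ <_) (+-comm 1 a₀) ≤-refl
    ; d≤a₀+m = ≤-trans a₀>0 (m≤m+n a₀ a₀)
    ; cofactor = D ∸ a₀ * a₀
    ; norm = trans (cong (_+ a₀ * a₀) (*-identityˡ _)) (m∸n+n≡m (<⇒≤ a₀²<D))
    }

  m[1]≡a₀ : m[ 1 ] ≡ a₀
  m[1]≡a₀ = trans (*-identityʳ _) (trans (n/1≡n (a₀ + 0)) (+-identityʳ a₀))

  -- The orbit starts at (0, 1), but from n = 1 on it is the orbit of the reduced pair (a₀, 1).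
  state-1 : state D 1 ≡ next (a₀ , 1)
  state-1 = cong (λ x → x , divN (D ∸ x * x) 1) (trans m[1]≡a₀ (sym nextM-a₀-1))
    where
    nextM-a₀-1 : nextM a₀ 1 ≡ a₀
    nextM-a₀-1 = trans (cong (_∸ a₀) (trans (*-identityʳ _) (n/1≡n (a₀ + a₀)))) (m+n∸n≡m a₀ a₀)

  reduced-orbit : ∀ n → Reduced m[ suc n ] d[ suc n ]
  reduced-orbit zero = subst (λ s → Reduced (proj₁ s) (proj₂ s)) (sym state-1) (Step.reduced-next reduced-a₀-1)
  reduced-orbit (suc n) = Step.reduced-next (reduced-orbit n)

  d>0 : ∀ n → 0 < d[ n ]
  d>0 zero = z<s
  d>0 (suc n) = Reduced⇒d>0 (reduced-orbit n)

  m-recurrence : ∀ n → m[ suc n ] + m[ n ] ≡ a[ n ] * d[ n ]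
  m-recurrence zero = +-identityʳ _
  m-recurrence (suc n) = Step.m'+m≡q*d (reduced-orbit n)

  d-recurrence : ∀ n → d[ n ] * d[ suc n ] + m[ suc n ] * m[ suc n ] ≡ D
  d-recurrence zero =
    subst (λ s → 1 * proj₂ s + proj₁ s * proj₁ s ≡ D) (sym state-1) (Step.d*d'+m'²≡D reduced-a₀-1)
  d-recurrence (suc n) = Step.d*d'+m'²≡D (reduced-orbit n)

  a≡partialQuotient-next : ∀ n → a[ suc n ] ≡ partialQuotient m[ suc (suc n) ] d[ suc n ]
  a≡partialQuotient-next n = sym (Step.partialQuotient-nextM (reduced-orbit n))

  a≤a₀ : ∀ n → 2 ≤ d[ suc n ] → a[ suc n ] ≤ a₀
  a≤a₀ n = Step.partialQuotient≤a₀ (reduced-orbit n)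

  repetition⇒return : ∀ i k → state D (suc i) ≡ state D (suc (i + k)) → state D 1 ≡ state D (suc k)
  repetition⇒return zero k eq = eq
  repetition⇒return (suc i) k eq =
    repetition⇒return i k (next-injective (reduced-orbit i) (reduced-orbit (i + k)) eq)

  -- Pigeonhole: reduced pairs have m ≤ a₀ and d ≤ 2a₀.
  state-repeats : ∃₂ λ i j → i < j × state D (suc i) ≡ state D (suc j)
  state-repeats =
    let (i , j , i<j , eq) = pigeonhole (n<1+n _) (encode ∘ toℕ)
    in  toℕ i , toℕ j , i<j , encode-injective {toℕ i} {toℕ j} eq
    where
    d≤2a₀ : ∀ n → d[ suc n ] ≤ a₀ + a₀
    d≤2a₀ n = ≤-trans (Reduced.d≤a₀+m (reduced-orbit n)) (+-monoʳ-≤ a₀ (Reduced.m≤a₀ (reduced-orbit n)))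
    encode : ℕ → Fin (suc a₀ * suc (a₀ + a₀))
    encode n = combine (fromℕ< (s≤s (Reduced.m≤a₀ (reduced-orbit n)))) (fromℕ< (s≤s (d≤2a₀ n)))
    encode-injective : ∀ {i j} → encode i ≡ encode j → state D (suc i) ≡ state D (suc j)
    encode-injective eq = let (m-eq , d-eq) = combine-injective _ _ _ _ eq in
      cong₂ _,_ (fromℕ<-injective _ _ _ _ m-eq) (fromℕ<-injective _ _ _ _ d-eq)

  returns-to-start : ∃[ L ] 0 < L × state D L ≡ (a₀ , 1)
  returns-to-start =
    let (i , j , i<j , eq) = state-repeats
    in  from-repetition i (m<n⇒0<n∸m i<j) (trans eq (cong (state D ∘ suc) (sym (m+[n∸m]≡n (<⇒≤ i<j)))))
    where
    from-repetition : ∀ i {k} → 0 < k → state D (suc i) ≡ state D (suc (i + k)) →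
                      ∃[ L ] 0 < L × state D L ≡ (a₀ , 1)
    from-repetition i {suc k} _ eq = suc k , z<s ,
      sym (next-injective reduced-a₀-1 (reduced-orbit k) (trans (sym state-1) (repetition⇒return i (suc k) eq)))

  start⇒IsPeriod : ∀ {L} → 0 < L → state D L ≡ (a₀ , 1) → IsPeriod D L
  start⇒IsPeriod {L} L>0 start =
    L>0 , λ { (suc n) _ → cong (λ s → partialQuotient (proj₁ s) (proj₂ s)) (shift n) }
    where
    shift : ∀ n → state D (suc n + L) ≡ state D (suc n)
    shift zero = trans (cong next start) (sym state-1)
    shift (suc n) = cong next (shift n)

  d≡1⇒start : ∀ {n} → 0 < n → d[ n ] ≡ 1 → state D n ≡ (a₀ , 1)
  d≡1⇒start {suc n} _ d≡1 = cong₂ _,_ m≡a₀ d≡1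
    where
    r = reduced-orbit n
    m≡a₀ : m[ suc n ] ≡ a₀
    m≡a₀ = ≤-antisym (Reduced.m≤a₀ r)
      (s≤s⁻¹ (subst (a₀ <_) (trans (cong (m[ suc n ] +_) d≡1) (+-comm _ 1)) (Reduced.a₀<m+d r)))

  start⇒a≡2a₀ : ∀ {n} → state D n ≡ (a₀ , 1) → a[ n ] ≡ a₀ + a₀
  start⇒a≡2a₀ start = trans (cong (λ s → partialQuotient (proj₁ s) (proj₂ s)) start) (n/1≡n (a₀ + a₀))

  a≡2a₀⇒d≡1 : ∀ {n} → 0 < n → a[ n ] ≡ a₀ + a₀ → d[ n ] ≡ 1
  a≡2a₀⇒d≡1 {suc n} _ a≡2a₀ = decidable-stable (d[ suc n ] ≟ 1) λ d≢1 →
    <⇒≱ a₀<2a₀ (subst (_≤ a₀) a≡2a₀ (a≤a₀ n (≢1⇒≥2 (d>0 (suc n)) d≢1)))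

  convergents : ∀ n → ∃[ P ] ∃[ Q ] ∃[ P' ] ∃[ Q' ] Convergents D m[ n ] d[ n ] P Q P' Q'
  convergents zero = 1 , 0 , 0 , 1 , record { numerator = refl ; conjugate = sym (*-zeroʳ D) ; unimodular = inj₁ refl }
  convergents (suc n) =
    let (P , Q , P' , Q' , c) = convergents n
    in  a[ n ] * P + P' , a[ n ] * Q + Q' , P , Q ,
        convergents-next {a = a[ n ]} {{>-nonZero (d>0 n)}} (m-recurrence n) (d-recurrence n) c

  ±d-is-norm : ∀ n → ∃₂ λ X Y → X * X ≡ D * (Y * Y) + d[ n ] ⊎ X * X + d[ n ] ≡ D * (Y * Y)
  ±d-is-norm n = let (P , Q , _ , _ , c) = convergents n in P , Q , convergents-norm c

-- The minimal period

module MinimalPeriod (D : ℕ) (nonSquare : ∀ s → s * s ≢ D) (T : ℕ) (minimal : IsMinPeriod D T) where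
  open ContinuedFraction D nonSquare public

  T>0 : 0 < T
  T>0 = proj₁ (proj₁ minimal)

  a[T]≡2a₀ : a[ T ] ≡ a₀ + a₀
  a[T]≡2a₀ = let (L , L>0 , start) = returns-to-start in begin
    a[ T ]        ≡⟨ sym (proj₂ (start⇒IsPeriod L>0 start) T T>0) ⟩
    a[ T + L ]    ≡⟨ cong a[_] (+-comm T L) ⟩
    a[ L + T ]    ≡⟨ proj₂ (proj₁ minimal) L L>0 ⟩
    a[ L ]        ≡⟨ start⇒a≡2a₀ start ⟩
    a₀ + a₀       ∎
    where open ≡-Reasoning

  d[T]≡1 : d[ T ] ≡ 1
  d[T]≡1 = a≡2a₀⇒d≡1 T>0 a[T]≡2a₀

  d≢1-within-period : ∀ {j} → 0 < j → j < T → d[ j ] ≢ 1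
  d≢1-within-period j>0 j<T d≡1 = <⇒≱ j<T (proj₂ minimal _ (start⇒IsPeriod j>0 (d≡1⇒start j>0 d≡1)))

  a≤a₀-within-period : ∀ {j} → 0 < j → j < T → a[ j ] ≤ a₀
  a≤a₀-within-period {suc n} j>0 j<T = a≤a₀ n (≢1⇒≥2 (d>0 (suc n)) (d≢1-within-period j>0 j<T))

  mirror : ∀ i j → suc i + suc j ≡ T → m[ suc (suc j) ] ≡ m[ suc i ] × d[ suc j ] ≡ d[ suc i ]
  mirror zero j j+2≡T = m-eq , d-eq
    where
    open ≡-Reasoning
    m-eq : m[ suc (suc j) ] ≡ m[ 1 ]
    m-eq = begin
      m[ suc (suc j) ]   ≡⟨ cong m[_] j+2≡T ⟩
      m[ T ]             ≡⟨ cong proj₁ (d≡1⇒start T>0 d[T]≡1) ⟩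
      a₀                 ≡⟨ sym m[1]≡a₀ ⟩
      m[ 1 ]             ∎
    d-eq : d[ suc j ] ≡ d[ 1 ]
    d-eq = *-cancelʳ-≡ _ _ 1 (+-cancelʳ-≡ (m[ 1 ] * m[ 1 ]) _ _ (begin
      d[ suc j ] * 1 + m[ 1 ] * m[ 1 ]
        ≡⟨ cong₂ (λ x y → d[ suc j ] * x + y * y) (sym (trans (cong d[_] j+2≡T) d[T]≡1)) (sym m-eq) ⟩
      d[ suc j ] * d[ suc (suc j) ] + m[ suc (suc j) ] * m[ suc (suc j) ]
        ≡⟨ trans (d-recurrence (suc j)) (sym (d-recurrence 0)) ⟩
      1 * d[ 1 ] + m[ 1 ] * m[ 1 ]
        ≡⟨ cong (_+ m[ 1 ] * m[ 1 ]) (*-comm 1 d[ 1 ]) ⟩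
      d[ 1 ] * 1 + m[ 1 ] * m[ 1 ]       ∎))
  mirror (suc i) j i+j+4≡T = m-eq , d-eq
    where
    open ≡-Reasoning
    inner = mirror i (suc j) (trans (cong suc (+-suc i (suc j))) i+j+4≡T)
    a-eq : a[ suc (suc j) ] ≡ a[ suc i ]
    a-eq = trans (a≡partialQuotient-next (suc j)) (cong₂ partialQuotient (proj₁ inner) (proj₂ inner))
    m-eq : m[ suc (suc j) ] ≡ m[ suc (suc i) ]
    m-eq = +-cancelˡ-≡ m[ suc i ] _ _ (begin
      m[ suc i ] + m[ suc (suc j) ]                  ≡⟨ cong (_+ m[ suc (suc j) ]) (sym (proj₁ inner)) ⟩
      m[ suc (suc (suc j)) ] + m[ suc (suc j) ]      ≡⟨ m-recurrence (suc (suc j)) ⟩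
      a[ suc (suc j) ] * d[ suc (suc j) ]            ≡⟨ cong₂ _*_ a-eq (proj₂ inner) ⟩
      a[ suc i ] * d[ suc i ]                        ≡⟨ sym (m-recurrence (suc i)) ⟩
      m[ suc (suc i) ] + m[ suc i ]                  ≡⟨ +-comm _ m[ suc i ] ⟩
      m[ suc i ] + m[ suc (suc i) ]                  ∎)
    d-eq : d[ suc j ] ≡ d[ suc (suc i) ]
    d-eq = *-cancelʳ-≡ _ _ d[ suc i ] {{>-nonZero (d>0 (suc i))}}
      (+-cancelʳ-≡ (m[ suc (suc i) ] * m[ suc (suc i) ]) _ _ (begin
        d[ suc j ] * d[ suc i ] + m[ suc (suc i) ] * m[ suc (suc i) ]
          ≡⟨ cong₂ (λ x y → d[ suc j ] * x + y * y) (sym (proj₂ inner)) (sym m-eq) ⟩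
        d[ suc j ] * d[ suc (suc j) ] + m[ suc (suc j) ] * m[ suc (suc j) ]
          ≡⟨ trans (d-recurrence (suc j)) (sym (d-recurrence (suc i))) ⟩
        d[ suc i ] * d[ suc (suc i) ] + m[ suc (suc i) ] * m[ suc (suc i) ]
          ≡⟨ cong (_+ m[ suc (suc i) ] * m[ suc (suc i) ]) (*-comm d[ suc i ] _) ⟩
        d[ suc (suc i) ] * d[ suc i ] + m[ suc (suc i) ] * m[ suc (suc i) ] ∎))

  a-palindrome : ∀ i j → suc i + suc j ≡ T → a[ suc j ] ≡ a[ suc i ]
  a-palindrome i j i+j+2≡T = trans (a≡partialQuotient-next j)
    (cong₂ partialQuotient (proj₁ (mirror i j i+j+2≡T)) (proj₂ (mirror i j i+j+2≡T)))

  odd-period⇒sum-of-two-squares : ∀ {h} → T ≡ suc (h + h) → ∃₂ λ x y → x * x + y * y ≡ D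
  odd-period⇒sum-of-two-squares {zero} T≡1 = 1 , m[ 1 ] ,
    trans (cong (λ x → 1 * x + m[ 1 ] * m[ 1 ]) (sym (trans (cong d[_] (sym T≡1)) d[T]≡1))) (d-recurrence 0)
  odd-period⇒sum-of-two-squares {suc h} T≡2h+3 = d[ suc h ] , m[ suc (suc h) ] ,
    trans (cong (λ x → d[ suc h ] * x + m[ suc (suc h) ] * m[ suc (suc h) ]) (proj₂ (mirror (suc h) h (sym T≡2h+3))))
          (d-recurrence (suc h))

  module Centre {h : ℕ} (T≡2h+2 : T ≡ suc h + suc h) where

    m-centre : m[ suc h ] + m[ suc h ] ≡ a[ suc h ] * d[ suc h ]
    m-centre = trans (cong (_+ m[ suc h ]) (sym (proj₁ (mirror h h (sym T≡2h+2))))) (m-recurrence (suc h))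

    d≢1 : d[ suc h ] ≢ 1
    d≢1 = d≢1-within-period z<s (subst (suc h <_) (sym T≡2h+2) (s≤s (m≤n+m (suc h) h)))

  IsCentralQuotient : ℕ → Set
  IsCentralQuotient a = ∃[ h ] T ≡ suc h + suc h × a[ suc h ] ≡ a

  private
    hits : ℕ → ℕ → ℕ
    hits a i = indicator (a[ suc i ] ≟ a)

  count≡sumUpTo : ∀ a {n} → T ≡ suc n → count D T a ≡ sumUpTo (hits a) n + hits a n
  count≡sumUpTo a {n} T≡1+n = begin
    length (filter (λ j → a[ j ] ≟ a) (map suc (upTo T)))
      ≡⟨ cong (length ∘ filter _) (map-applyUpTo id suc T) ⟩
    length (filter (λ j → a[ j ] ≟ a) (applyUpTo suc T))
      ≡⟨ length-filter-applyUpTo (λ j → a[ j ] ≟ a) suc T ⟩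
    sumUpTo (hits a) T
      ≡⟨ cong (sumUpTo (hits a)) T≡1+n ⟩
    sumUpTo (hits a) (suc n)
      ≡⟨ sumUpTo-suc (hits a) n ⟩
    sumUpTo (hits a) n + hits a n  ∎
    where open ≡-Reasoning

  hits-palindromic : ∀ a {n} → T ≡ suc n → Palindromic (hits a) n
  hits-palindromic a T≡1+n i j i+j+1≡n = cong (λ x → indicator (x ≟ a)) (a-palindrome j i (begin
    suc j + suc i      ≡⟨ cong suc (trans (+-suc j i) (cong suc (+-comm j i))) ⟩
    suc (suc (i + j))  ≡⟨ cong suc i+j+1≡n ⟩
    suc _              ≡⟨ sym T≡1+n ⟩
    T                  ∎))
    where open ≡-Reasoning

  last≡a⇔ : ∀ {a n} → T ≡ suc n → a[ suc n ] ≡ a ⇔ a ≡ a₀ + a₀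
  last≡a⇔ T≡1+n = mk⇔ (λ e → trans (sym e) (trans (cong a[_] (sym T≡1+n)) a[T]≡2a₀))
                      (λ e → trans (cong a[_] (sym T≡1+n)) (trans a[T]≡2a₀ (sym e)))

  count-odd⇔-odd-period : ∀ a {n k} → T ≡ suc n → Even n → sumUpTo (hits a) n ≡ k + k →
                          Odd (count D T a) ⇔ (a ≡ a₀ + a₀ ⊎ IsCentralQuotient a)
  count-odd⇔-odd-period a {n} {k} T≡1+n n-even S≡2k =
    ⇔-trans (odd-double+indicator⇔ k (a[ suc n ] ≟ a) (trans (count≡sumUpTo a T≡1+n) (cong (_+ hits a n) S≡2k)))
            (mk⇔ (inj₁ ∘ Equivalence.to (last≡a⇔ T≡1+n))
                 [ Equivalence.from (last≡a⇔ T≡1+n) , ⊥-elim ∘ not-central ])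
    where
    not-central : ¬ IsCentralQuotient a
    not-central (h , T≡2h+2 , _) =
      even⇒¬odd n-even (h , suc-injective (trans (sym T≡1+n) (trans T≡2h+2 (cong suc (+-suc h h)))))

  count-odd⇔-even-period : ∀ a {n h k} → T ≡ suc n → n ≡ suc (h + h) →
                           sumUpTo (hits a) n ≡ k + k + hits a h →
                           Odd (count D T a) ⇔ (a ≡ a₀ + a₀ ⊎ IsCentralQuotient a)
  count-odd⇔-even-period a {n} {h} {k} T≡1+n n≡2h+1 S≡2k+centre =
    ⇔-trans (odd-double+indicators⇔ k (a[ suc h ] ≟ a) (a[ suc n ] ≟ a) not-both
               (trans (count≡sumUpTo a T≡1+n) (cong (_+ hits a n) S≡2k+centre)))
            (mk⇔ [ inj₂ ∘ (λ e → h , T≡2h+2 , e) , inj₁ ∘ Equivalence.to (last≡a⇔ T≡1+n) ]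
                 [ inj₂ ∘ Equivalence.from (last≡a⇔ T≡1+n) , inj₁ ∘ central ])
    where
    T≡2h+2 : T ≡ suc h + suc h
    T≡2h+2 = trans T≡1+n (cong suc (trans n≡2h+1 (sym (+-suc h h))))
    central : IsCentralQuotient a → a[ suc h ] ≡ a
    central (h' , T≡2h'+2 , e) =
      subst (λ i → a[ suc i ] ≡ a) (suc-injective (double-injective (trans (sym T≡2h'+2) T≡2h+2))) e
    not-both : ¬ (a[ suc h ] ≡ a × a[ suc n ] ≡ a)
    not-both (e , e') = <⇒≱ a₀<2a₀ (begin
      a₀ + a₀      ≡⟨ sym (Equivalence.to (last≡a⇔ T≡1+n) e') ⟩
      a            ≡⟨ sym e ⟩
      a[ suc h ]   ≤⟨ a≤a₀-within-period z<s (subst (suc h <_) (sym T≡2h+2) (s≤s (m≤n+m (suc h) h))) ⟩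
      a₀           ∎)
      where open ≤-Reasoning

  -- a_1, …, a_{T−1} is a palindrome, so only a_T and, for even T, the central term are unpaired.
  count-odd⇔ : ∀ a → Odd (count D T a) ⇔ (a ≡ a₀ + a₀ ⊎ IsCentralQuotient a)
  count-odd⇔ a =
    [ (λ (n-even , k , S≡2k) → count-odd⇔-odd-period a {k = k} T≡1+n n-even S≡2k)
    , (λ (h , n≡2h+1 , k , S≡2k+centre) → count-odd⇔-even-period a {h = h} {k} T≡1+n n≡2h+1 S≡2k+centre)
    ]′ (palindromic-sum (pred T) (hits a) (hits-palindromic a T≡1+n))
    where
    T≡1+n : T ≡ suc (pred T)
    T≡1+n = sym (suc-pred T {{>-nonZero T>0}})

-- D = p and D = 2p

module PrimeCase (p : ℕ) (p-prime : Prime p) (T : ℕ) (minimal : IsMinPeriod p T) where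
  open MinimalPeriod p (prime⇒nonSquare p-prime) T minimal

  module EvenPeriod {h : ℕ} (T≡2h+2 : T ≡ suc h + suc h) where
    open Centre T≡2h+2

    private
      r = reduced-orbit h
      m = m[ suc h ]

    m<p : m < p
    m<p = ≤-<-trans (Reduced.m≤a₀ r)
      (square<k*p⇒<p (subst (a₀ * a₀ <_) (sym (*-identityˡ p)) a₀²<D) (<⇒≤ (prime>1 p-prime)))

    d≡2 : d[ suc h ] ≡ 2
    d≡2 = centre-denominator-prime {q = a[ suc h ]} p-prime (Reduced⇒m>0 r) m<p m-centre
      (trans (cong (_+ m * m) (*-comm d[ suc h ] d[ h ])) (d-recurrence h)) d≢1

    a≡m : a[ suc h ] ≡ m
    a≡m = sym (double-injective (trans m-centre (trans (cong (a[ suc h ] *_) d≡2) (n*2≡n+n a[ suc h ]))))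

    window : Window m
    window = Reduced.m≤a₀ r , subst (λ x → a₀ < m + x) d≡2 (Reduced.a₀<m+d r)

    m-odd×p-odd : Odd m × Odd p
    m-odd×p-odd = prime-centre-odd {e = d[ h ]} p-prime (Reduced⇒m>0 r) m<p
      (trans (cong (λ x → d[ h ] * x + m * m) (sym d≡2)) (d-recurrence h))

    p%4≢1 : p % 4 ≢ 1
    p%4≢1 p%4≡1 = let (X , Y , norm) = ±d-is-norm (suc h) in
      no-norm-±2 {p} {X} {Y} p%4≡1 (subst (λ d → X * X ≡ p * (Y * Y) + d ⊎ X * X + d ≡ p * (Y * Y)) d≡2 norm)

    p%4≡3 : p % 4 ≡ 3
    p%4≡3 = [ flip contradiction p%4≢1 , id ] (odd⇒%4≡1⊎%4≡3 (proj₂ m-odd×p-odd))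

  central⇔ : ∀ a → IsCentralQuotient a ⇔ (a % 2 ≡ 1 × p % 4 ≡ 3 × a * a < p × p < (a + 2) * (a + 2))
  central⇔ a = mk⇔ to from
    where
    to : IsCentralQuotient a → a % 2 ≡ 1 × p % 4 ≡ 3 × a * a < p × p < (a + 2) * (a + 2)
    to (h , T≡2h+2 , a[1+h]≡a) =
      odd⇒%2≡1 (subst Odd m≡a (proj₁ m-odd×p-odd)) , p%4≡3 , Equivalence.to window⇔ (subst Window m≡a window)
      where
      open EvenPeriod T≡2h+2
      m≡a = trans (sym a≡m) a[1+h]≡a
    from : a % 2 ≡ 1 × p % 4 ≡ 3 × a * a < p × p < (a + 2) * (a + 2) → IsCentralQuotient a
    from (a%2≡1 , p%4≡3 , bracket) = [ even-period , ⊥-elim ∘ odd-period ]′ (even-or-odd T)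
      where
      odd-period : ¬ Odd T
      odd-period (h , T≡2h+1) =
        let (x , y , x²+y²≡p) = odd-period⇒sum-of-two-squares {h} T≡2h+1
        in  sum-of-squares%4≢3 x y (trans (cong (_% 4) x²+y²≡p) p%4≡3)
      even-period : Even T → IsCentralQuotient a
      even-period (zero , T≡0) = ⊥-elim (<⇒≢ T>0 (sym T≡0))
      even-period (suc h , T≡2h+2) = h , T≡2h+2 ,
        trans a≡m (window-unique (trans (odd⇒%2≡1 (proj₁ m-odd×p-odd)) (sym a%2≡1))
                                 window (Equivalence.from window⇔ bracket))
        where open EvenPeriod T≡2h+2

  count-parity : ∀ a → (count p T a % 2 ≡ 1) ⇔
                 ((a % 2 ≡ 1 × p % 4 ≡ 3 × a * a < p × p < (a + 2) * (a + 2))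
                  ⊎ (a % 2 ≡ 0 × a * a < 4 * p × 4 * p < (a + 2) * (a + 2)))
  count-parity a =
    ⇔-trans %2≡1⇔odd (⇔-trans (count-odd⇔ a) (⇔-trans (twice-a₀⇔ ⊎-⇔ central⇔ a) (mk⇔ swap swap)))

module TwicePrimeCase (p : ℕ) (p-prime : Prime p) (p-odd : Odd p) (T : ℕ) (minimal : IsMinPeriod (2 * p) T) where
  open MinimalPeriod (2 * p) (twice-odd-nonSquare p-odd) T minimal

  module EvenPeriod {h : ℕ} (T≡2h+2 : T ≡ suc h + suc h) where
    open Centre T≡2h+2

    private
      r = reduced-orbit h
      m = m[ suc h ]

    m<p : m < p
    m<p = ≤-<-trans (Reduced.m≤a₀ r) (square<k*p⇒<p a₀²<D (prime>1 p-prime))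

    d≡2 : d[ suc h ] ≡ 2
    d≡2 = centre-denominator-twice-prime {q = a[ suc h ]} p-prime p-odd (Reduced⇒m>0 r) m<p m-centre
      (trans (cong (_+ m * m) (*-comm d[ suc h ] d[ h ])) (d-recurrence h)) d≢1

    a≡m : a[ suc h ] ≡ m
    a≡m = sym (double-injective (trans m-centre (trans (cong (a[ suc h ] *_) d≡2) (n*2≡n+n a[ suc h ]))))

    window : Window m
    window = Reduced.m≤a₀ r , subst (λ x → a₀ < m + x) d≡2 (Reduced.a₀<m+d r)

    m-even : Even m
    m-even = twice-centre-even {p} {d[ h ]} (trans (cong (λ x → d[ h ] * x + m * m) (sym d≡2)) (d-recurrence h))

  central⇔ : ∀ a → IsCentralQuotient a ⇔ (a % 2 ≡ 0 × a * a < 2 * p × 2 * p < (a + 2) * (a + 2) × T % 2 ≡ 0)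
  central⇔ a = mk⇔ to from
    where
    to : IsCentralQuotient a → a % 2 ≡ 0 × a * a < 2 * p × 2 * p < (a + 2) * (a + 2) × T % 2 ≡ 0
    to (h , T≡2h+2 , a[1+h]≡a) =
      let (lower , upper) = Equivalence.to window⇔ (subst Window m≡a window)
      in  even⇒%2≡0 (subst Even m≡a m-even) , lower , upper , even⇒%2≡0 (suc h , T≡2h+2)
      where
      open EvenPeriod T≡2h+2
      m≡a = trans (sym a≡m) a[1+h]≡a
    from : a % 2 ≡ 0 × a * a < 2 * p × 2 * p < (a + 2) * (a + 2) × T % 2 ≡ 0 → IsCentralQuotient a
    from (a%2≡0 , lower , upper , T%2≡0) = even-period (%2≡0⇒even {T} T%2≡0)
      where
      even-period : Even T → IsCentralQuotient a
      even-period (zero , T≡0) = ⊥-elim (<⇒≢ T>0 (sym T≡0))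
      even-period (suc h , T≡2h+2) = h , T≡2h+2 ,
        trans a≡m (window-unique (trans (even⇒%2≡0 m-even) (sym a%2≡0))
                                 window (Equivalence.from window⇔ (lower , upper)))
        where open EvenPeriod T≡2h+2

  count-parity : ∀ a → (count (2 * p) T a % 2 ≡ 1) ⇔
                 (a % 2 ≡ 0 × ((a * a < 8 * p × 8 * p < (a + 2) * (a + 2))
                               ⊎ (a * a < 2 * p × 2 * p < (a + 2) * (a + 2) × T % 2 ≡ 0)))
  count-parity a =
    ⇔-trans %2≡1⇔odd (⇔-trans (count-odd⇔ a) (⇔-trans (twice-a₀⇔′ ⊎-⇔ central⇔ a) factor-parity))
    where
    twice-a₀⇔′ : a ≡ a₀ + a₀ ⇔ (a % 2 ≡ 0 × a * a < 8 * p × 8 * p < (a + 2) * (a + 2))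
    twice-a₀⇔′ = subst (λ n → a ≡ a₀ + a₀ ⇔ (a % 2 ≡ 0 × a * a < n × n < (a + 2) * (a + 2)))
                       (sym (*-assoc 4 2 p)) twice-a₀⇔
    factor-parity : ∀ {E A B : Set} → ((E × A) ⊎ (E × B)) ⇔ (E × (A ⊎ B))
    factor-parity = mk⇔ [ (λ (e , a) → e , inj₁ a) , (λ (e , b) → e , inj₂ b) ]
                        (λ { (e , inj₁ a) → inj₁ (e , a) ; (e , inj₂ b) → inj₂ (e , b) })

theorem1p1 : (a p : ℕ) → 1 ≤ a → Prime p →
    ((T : ℕ) → IsMinPeriod p T →
      ((count p T a % 2 ≡ 1) ⇔
        ((a % 2 ≡ 1 × p % 4 ≡ 3 × a * a < p × p < (a + 2) * (a + 2))
         ⊎ (a % 2 ≡ 0 × a * a < 4 * p × 4 * p < (a + 2) * (a + 2)))))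
    × (p % 2 ≡ 1 → (T : ℕ) → IsMinPeriod (2 * p) T →
      ((count (2 * p) T a % 2 ≡ 1) ⇔
        (a % 2 ≡ 0 ×
          ((a * a < 8 * p × 8 * p < (a + 2) * (a + 2))
           ⊎ (a * a < 2 * p × 2 * p < (a + 2) * (a + 2) × T % 2 ≡ 0)))))
theorem1p1 a p _ p-prime =
  (λ T minimal → PrimeCase.count-parity p p-prime T minimal a) ,
  (λ p%2≡1 T minimal → TwicePrimeCase.count-parity p p-prime (%2≡1⇒odd p%2≡1) T minimal a)
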